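{- Let $\phi$ be a max positive 1-in-3 SAT instance with $n$ variables and $m \le n$ clauses, let $0<\xi<\varepsilon<1$, and let $\tilde X \in \mathbb{R}^{(4n+m)\times 3n}$ be the matrix defined in the context. If $u \in \{0,1\}^{3n}$ is an assignment vector, then $\|u\|^2 = \|u\|_0 = 2n$ and $$ n + \varepsilon^2 \alpha m \le \|\tilde X u\|^2 \le n + 4\varepsilon^2\alpha m, $$ where $\alpha$ is the proportion of clauses of $\phi$ not satisfied by the true/false assignment corresponding to $u$. Moreover, if no clause of $\phi$ contains three true variables under this assignment, then the lower bound holds with equality.
   Context: A max positive 1-in-3 SAT instance is a set of clauses, each consisting of at most $3$ (un-negated) boolean variables from $\{x_1,\dots,x_n\}$; a clause is satisfied by an assignment iff exactly one of its variables is true. Given such an instance $\phi$ with $m$ clauses, define $\Phi\in\mathbb{R}^{m\times n}$ by $\Phi_{ij}=1$ if variable $j$ appears in clause $i$ and $\Phi_{ij}=0$ otherwise. Let $I$ be the $n\times n$ identity, $\mathbb{1}$ the all-ones vector in $\mathbb{R}^n$, $P = I - \frac1n \mathbb{1}\mathbb{1}^\top$, and $I'$ the $m\times n$ matrix consisting of the first $m$ rows of $I$ (here $m\le n$). Define the block matrix $$\tilde X = \begin{pmatrix} I & 0 & 0 \\ 0 & I & 0 \\ 0 & 0 & \xi^{ -1}P \\ \xi^{ -1} I & \xi^{ -1} I & -\xi^{ -1} I \\ \varepsilon\Phi & 0 & -\varepsilon I'\end{pmatrix}.$$ A vector $u\in\{0,1\}^{3n}$ is an assignment vector if $u_i + u_{i+n}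 = 1$ for $1\le i\le n$ and $u_j = 1$ for $2n<j\le 3n$; it corresponds to the assignment setting $x_i$ true iff $u_i=1$ (and false iff $u_{i+n}=1$). $\|u\|_0$ denotes the number of nonzero entries of $u$.
   Formalization: The parameters ξ and ε are rational, and the matrix $\tilde X$ has entries in ℚ rather than ℝ. -}

module Defs where

open import Data.Nat as ℕ using (ℕ; zero; suc)
open import Data.Integer using (+_)
open import Data.Fin using (Fin; zero; suc; toℕ; splitAt; _↑ˡ_; _↑ʳ_)
open import Data.Fin.Subset using (Subset; _∈_; _∩_; ∣_∣)
open import Data.Fin.Subset.Properties using (_∈?_)
open import Data.Sum using ([_,_])
open import Data.Bool using (Bool; true; false; if_then_else_)
open import Data.Vec using (tabulate)
open import Relation.Nullary using (does)
open import Data.Rational as ℚ using (ℚ; 0ℚ; 1ℚ; _+_; _*_; _-_; _<_; 1/_; _/_)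
open import Data.Rational.Properties using (pos⇒nonZero)

ℕtoℚ : ℕ → ℚ
ℕtoℚ k = + k / 1

b2q : Bool → ℚ
b2q true  = 1ℚ
b2q false = 0ℚ

-- real (here: rational) matrices and vectors as functions on Fin
Mat : ℕ → ℕ → Set
Mat m k = Fin m → Fin k → ℚ

Vect : ℕ → Set
Vect k = Fin k → ℚ

sumF : ∀ {k} → (Fin k → ℚ) → ℚ
sumF {zero}  f = 0ℚ
sumF {suc k} f = f zero + sumF (λ i → f (suc i))

countF : ∀ {k} → (Fin k → Bool) → ℕ
countF {zero}  p = 0
countF {suc k} p = (if p zero then 1 else 0) ℕ.+ countF (λ i → p (suc i))

_·_ : ∀ {m k} → Mat m k → Vect k → Vect m
(A · v) i = sumF (λ j → A i j * v j)

‖_‖² : ∀ {k} → Vect k → ℚ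
‖ v ‖² = sumF (λ i → v i * v i)

‖_‖₀ : ∀ {k} → Vect k → ℕ
‖ v ‖₀ = countF (λ i → if does (v i ℚ.≟ 0ℚ) then false else true)

vcat : ∀ {a b k} → Mat a k → Mat b k → Mat (a ℕ.+ b) k
vcat {a} A B i j = [ (λ i' → A i' j) , (λ i' → B i' j) ] (splitAt a i)

hcat : ∀ {m a b} → Mat m a → Mat m b → Mat m (a ℕ.+ b)
hcat {a = a} A B i j = [ A i , B i ] (splitAt a j)

scale : ∀ {m k} → ℚ → Mat m k → Mat m k
scale c A i j = c * A i j

zeroM : ∀ {m k} → Mat m k
zeroM _ _ = 0ℚ

δ : ℕ → ℕ → ℚ
δ a b = if does (a ℕ.≟ b) then 1ℚ else 0ℚ

Id : ∀ {k} → Mat k k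
Id i j = δ (toℕ i) (toℕ j)

I′ : ∀ {m k} → Mat m k
I′ i j = δ (toℕ i) (toℕ j)

Pmat : ∀ {k} → Mat k k
Pmat {zero}  ()
Pmat {suc k} i j = δ (toℕ i) (toℕ j) - (+ 1 / suc k)

-- a (positive) 1-in-3 SAT instance: m clauses over n variables,
-- each clause a set of variables of size at most 3
Instance : ℕ → ℕ → Set
Instance n m = Fin m → Subset n

WellFormed : ∀ {n m} → Instance n m → Set
WellFormed φ = ∀ c → ∣ φ c ∣ ℕ.≤ 3

Φmat : ∀ {n m} → Instance n m → Mat m n
Φmat φ c j = if does (j ∈? φ c) then 1ℚ else 0ℚ

inv : (ξ : ℚ) → 0ℚ < ξ → ℚ
inv ξ h = (1/ ξ) {{pos⇒nonZero ξ {{ℚ.positive h}}}}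

Xtilde : ∀ {n m} → Instance n m → (ξ ε : ℚ) → 0ℚ < ξ →
         Mat (n ℕ.+ n ℕ.+ n ℕ.+ n ℕ.+ m) (n ℕ.+ n ℕ.+ n)
Xtilde {n} {m} φ ξ ε ξpos =
  vcat {n ℕ.+ n ℕ.+ n ℕ.+ n} {m} (vcat {n ℕ.+ n ℕ.+ n} {n} (vcat {n ℕ.+ n} {n} (vcat {n} {n}
    (hcat {a = n ℕ.+ n} {b = n} (hcat {a = n} {b = n} Id zeroM) zeroM)
    (hcat {a = n ℕ.+ n} {b = n} (hcat {a = n} {b = n} zeroM Id) zeroM))
    (hcat {a = n ℕ.+ n} {b = n} (hcat {a = n} {b = n} zeroM zeroM) (scale ξi Pmat)))
    (hcat {a = n ℕ.+ n} {b = n} (hcat {a = n} {b = n} (scale ξi Id) (scale ξi Id)) (scale (ℚ.- ξi) Id)))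
    (hcat {a = n ℕ.+ n} {b = n} (hcat {a = n} {b = n} (scale ε (Φmat φ)) zeroM) (scale (ℚ.- ε) I′))
  where ξi = inv ξ ξpos

pos₁ pos₂ pos₃ : ∀ {n} → Fin n → Fin (n ℕ.+ n ℕ.+ n)
pos₁ {n} i = (i ↑ˡ n) ↑ˡ n
pos₂ {n} i = (n ↑ʳ i) ↑ˡ n
pos₃ {n} i = (n ℕ.+ n) ↑ʳ i

toVect : ∀ {k} → (Fin k → Bool) → Vect k
toVect u i = b2q (u i)

IsAssignment : ∀ {n} → (Fin (n ℕ.+ n ℕ.+ n) → Bool) → Set
IsAssignment {n} u =
  (∀ (i : Fin n) → b2q (u (pos₁ i)) + b2q (u (pos₂ i)) ≡ 1ℚ) ×
  (∀ (j : Fin n) → u (pos₃ j) ≡ true)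
  where open import Relation.Binary.PropositionalEquality using (_≡_)
        open import Data.Product using (_×_)

trueSet : ∀ {n} → (Fin (n ℕ.+ n ℕ.+ n) → Bool) → Subset n
trueSet u = tabulate (λ i → u (pos₁ i))

trueCount : ∀ {n m} → Instance n m → (Fin (n ℕ.+ n ℕ.+ n) → Bool) → Fin m → ℕ
trueCount φ u c = ∣ φ c ∩ trueSet u ∣

-- number of clauses NOT satisfied (i.e. not exactly one true variable);
-- this is α·m in the paper
unsatCount : ∀ {n m} → Instance n m → (Fin (n ℕ.+ n ℕ.+ n) → Bool) → ℕ
unsatCount φ u = countF (λ c → if does (trueCount φ u c ℕ.≟ 1) then false else true)

-- Write an assignment vector as u = (x, 1 − x, 1) with x ∈ {0,1}ⁿ. Its entries are 0/1, so
-- ‖u‖² = ‖u‖₀ = |x| + (n − |x|) + n = 2n. Block by block,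
--   X̃u = (x, 1 − x, ξ⁻¹P1, ξ⁻¹(x + (1 − x) − 1), ε(Φx − 1))
-- and P1 = 0, so ‖X̃u‖² = n + ε² Σ_c (t_c − 1)², where t_c ≤ 3 is the number of true variables
-- of clause c. The defect (t − 1)² is 0 for t = 1, 1 for t ∈ {0, 2} and 4 for t = 3, so it lies
-- between [t ≠ 1] and 4[t ≠ 1], with equality on the left unless t = 3.

module Submission where

open import Defs
open import Data.Nat as ℕ using (ℕ; zero; suc; s≤s)
import Data.Nat.Properties as ℕ
import Data.Integer as ℤ
open import Data.Integer.Properties using (pos-+)
open import Data.Integer.Tactic.RingSolver using (solve-∀)
open import Data.Rational as ℚ using (ℚ; 0ℚ; 1ℚ; _+_; _*_; _-_; -_; _≤_; _<_; toℚᵘ; NonNegative; nonNegative; nonPositive)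
open import Data.Rational.Properties
open import Data.Rational.Solver using (module +-*-Solver)
import Data.Rational.Unnormalised as ℚᵘ
import Data.Rational.Unnormalised.Properties as ℚᵘ
open import Data.Fin using (Fin; zero; suc; toℕ; _↑ˡ_; _↑ʳ_; inject≤)
open import Data.Fin.Properties using (splitAt-↑ˡ; splitAt-↑ʳ; toℕ-inject≤)
open import Data.Fin.Subset using (Subset; _∩_; ∣_∣)
open import Data.Fin.Subset.Properties using (_∈?_; ∣p∩q∣≤∣p∣)
open import Data.Bool using (Bool; true; false; not; if_then_else_)
open import Data.Vec using ([]; _∷_; tabulate)
open import Data.Product using (_×_; _,_; proj₁; proj₂)
open import Data.Sum using (inj₁; inj₂)
open import Function using (_∘_)
open import Relation.Nullary using (does)
open import Relation.Nullary.Decidable using (toWitness)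
open import Relation.Binary.PropositionalEquality
open import Data.Empty using (⊥-elim)

ℕtoℚ-+ : ∀ a b → ℕtoℚ (a ℕ.+ b) ≡ ℕtoℚ a + ℕtoℚ b
ℕtoℚ-+ a b = toℚᵘ-injective (begin
  toℚᵘ (ℕtoℚ (a ℕ.+ b))                      ≈⟨ toℚᵘ-fromℚᵘ _ ⟩
  ℚᵘ.mkℚᵘ (ℤ.+ (a ℕ.+ b)) 0                  ≈⟨ ℚᵘ.*≡* (trans (cong (ℤ._* ℤ.+ 1) (pos-+ a b)) (over-1 (ℤ.+ a) (ℤ.+ b))) ⟩
  ℚᵘ.mkℚᵘ (ℤ.+ a) 0 ℚᵘ.+ ℚᵘ.mkℚᵘ (ℤ.+ b) 0   ≈⟨ ℚᵘ.+-cong (toℚᵘ-fromℚᵘ (ℚᵘ.mkℚᵘ (ℤ.+ a) 0)) (toℚᵘ-fromℚᵘ (ℚᵘ.mkℚᵘ (ℤ.+ b) 0)) ⟨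
  toℚᵘ (ℕtoℚ a) ℚᵘ.+ toℚᵘ (ℕtoℚ b)           ≈⟨ toℚᵘ-homo-+ (ℕtoℚ a) (ℕtoℚ b) ⟨
  toℚᵘ (ℕtoℚ a + ℕtoℚ b)                     ∎)
  where
  open import Relation.Binary.Reasoning.Setoid ℚᵘ.≃-setoid
  over-1 : ∀ x y → (x ℤ.+ y) ℤ.* ℤ.+ 1 ≡ (x ℤ.* ℤ.+ 1 ℤ.+ y ℤ.* ℤ.+ 1) ℤ.* ℤ.+ 1
  over-1 = solve-∀

ℕtoℚ-*-inverse : ∀ k → ℕtoℚ (suc k) * (ℤ.+ 1 ℚ./ suc k) ≡ 1ℚ
ℕtoℚ-*-inverse k = toℚᵘ-injective (begin
  toℚᵘ (ℕtoℚ (suc k) * (ℤ.+ 1 ℚ./ suc k))          ≈⟨ toℚᵘ-homo-* (ℕtoℚ (suc k)) (ℤ.+ 1 ℚ./ suc k) ⟩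
  toℚᵘ (ℕtoℚ (suc k)) ℚᵘ.* toℚᵘ (ℤ.+ 1 ℚ./ suc k)   ≈⟨ ℚᵘ.*-cong (toℚᵘ-fromℚᵘ (ℚᵘ.mkℚᵘ (ℤ.+ suc k) 0))
                                                                (toℚᵘ-fromℚᵘ (ℚᵘ.mkℚᵘ (ℤ.+ 1) k)) ⟩
  ℚᵘ.mkℚᵘ (ℤ.+ suc k) 0 ℚᵘ.* ℚᵘ.mkℚᵘ (ℤ.+ 1) k       ≈⟨ ℚᵘ.*≡* (cancel (ℤ.+ k)) ⟩
  toℚᵘ 1ℚ                                          ∎)
  where
  open import Relation.Binary.Reasoning.Setoid ℚᵘ.≃-setoid
  cancel : ∀ x → ((ℤ.+ 1 ℤ.+ x) ℤ.* ℤ.+ 1) ℤ.* ℤ.+ 1 ≡ ℤ.+ 1 ℤ.* (ℤ.+ 1 ℤ.* (ℤ.+ 1 ℤ.+ x))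
  cancel = solve-∀

ℕtoℚ-suc : ∀ k → ℕtoℚ (suc k) ≡ 1ℚ + ℕtoℚ k
ℕtoℚ-suc = ℕtoℚ-+ 1

sumF-cong : ∀ {k} {f g : Fin k → ℚ} → (∀ i → f i ≡ g i) → sumF f ≡ sumF g
sumF-cong {zero}  f≗g = refl
sumF-cong {suc k} f≗g = cong₂ _+_ (f≗g zero) (sumF-cong (f≗g ∘ suc))

sumF-split : ∀ a {b} (f : Fin (a ℕ.+ b) → ℚ) →
             sumF f ≡ sumF (λ i → f (i ↑ˡ b)) + sumF (λ i → f (a ↑ʳ i))
sumF-split zero    f = sym (+-identityˡ _)
sumF-split (suc a) f = trans (cong (f zero +_) (sumF-split a (f ∘ suc))) (sym (+-assoc (f zero) _ _))

sumF-distrib-+ : ∀ {k} (f g : Fin k → ℚ) → sumF (λ i → f i + g i) ≡ sumF f + sumF g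
sumF-distrib-+ {zero}  f g = sym (+-identityˡ 0ℚ)
sumF-distrib-+ {suc k} f g =
  trans (cong (f zero + g zero +_) (sumF-distrib-+ (f ∘ suc) (g ∘ suc)))
        (solve 4 (λ a b c d → (a :+ b) :+ (c :+ d) := (a :+ c) :+ (b :+ d)) refl (f zero) (g zero) _ _)
  where open +-*-Solver

sumF-distribˡ-* : ∀ {k} c (f : Fin k → ℚ) → sumF (λ i → c * f i) ≡ c * sumF f
sumF-distribˡ-* {zero}  c f = sym (*-zeroʳ c)
sumF-distribˡ-* {suc k} c f = trans (cong (c * f zero +_) (sumF-distribˡ-* c (f ∘ suc)))
                                    (sym (*-distribˡ-+ c (f zero) _))

sumF-const : ∀ {k} c → sumF {k} (λ _ → c) ≡ ℕtoℚ k * c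
sumF-const {zero}  c = sym (*-zeroˡ c)
sumF-const {suc k} c = begin
  c + sumF {k} (λ _ → c)   ≡⟨ cong (c +_) (sumF-const {k} c) ⟩
  c + ℕtoℚ k * c           ≡⟨ cong (_+ ℕtoℚ k * c) (*-identityˡ c) ⟨
  1ℚ * c + ℕtoℚ k * c      ≡⟨ *-distribʳ-+ c 1ℚ (ℕtoℚ k) ⟨
  (1ℚ + ℕtoℚ k) * c        ≡⟨ cong (_* c) (ℕtoℚ-suc k) ⟨
  ℕtoℚ (suc k) * c         ∎
  where open ≡-Reasoning

sumF-zero : ∀ {k} → sumF {k} (λ _ → 0ℚ) ≡ 0ℚ
sumF-zero {k} = trans (sumF-const {k} 0ℚ) (*-zeroʳ (ℕtoℚ k))

sumF-mono-≤ : ∀ {k} {f g : Fin k → ℚ} → (∀ i → f i ≤ g i) → sumF f ≤ sumF g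
sumF-mono-≤ {zero}  f≤g = ≤-refl
sumF-mono-≤ {suc k} f≤g = +-mono-≤ (f≤g zero) (sumF-mono-≤ (f≤g ∘ suc))

sumF-δ : ∀ {k} (i : Fin k) (g : Fin k → ℚ) → sumF (λ j → δ (toℕ i) (toℕ j) * g j) ≡ g i
sumF-δ {suc k} zero g = begin
  1ℚ * g zero + sumF (λ j → 0ℚ * g (suc j))   ≡⟨ cong₂ _+_ (*-identityˡ (g zero)) (sumF-cong (*-zeroˡ ∘ g ∘ suc)) ⟩
  g zero + sumF {k} (λ _ → 0ℚ)                ≡⟨ cong (g zero +_) (sumF-zero {k}) ⟩
  g zero + 0ℚ                                 ≡⟨ +-identityʳ (g zero) ⟩
  g zero                                      ∎
  where open ≡-Reasoning
sumF-δ (suc i) g = begin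
  0ℚ * g zero + sumF (λ j → δ (toℕ i) (toℕ j) * g (suc j))   ≡⟨ cong (_+ sumF (λ j → δ (toℕ i) (toℕ j) * g (suc j))) (*-zeroˡ (g zero)) ⟩
  0ℚ + sumF (λ j → δ (toℕ i) (toℕ j) * g (suc j))            ≡⟨ +-identityˡ _ ⟩
  sumF (λ j → δ (toℕ i) (toℕ j) * g (suc j))                 ≡⟨ sumF-δ i (g ∘ suc) ⟩
  g (suc i)                                                  ∎
  where open ≡-Reasoning

sumF-b2q : ∀ {k} (f : Fin k → Bool) → sumF (b2q ∘ f) ≡ ℕtoℚ (countF f)
sumF-b2q {zero}  f = refl
sumF-b2q {suc k} f with f zero
... | true  = trans (cong (1ℚ +_) (sumF-b2q (f ∘ suc))) (sym (ℕtoℚ-suc (countF (f ∘ suc))))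
... | false = trans (+-identityˡ (sumF (b2q ∘ f ∘ suc))) (sumF-b2q (f ∘ suc))

countF-cong : ∀ {k} {f g : Fin k → Bool} → (∀ i → f i ≡ g i) → countF f ≡ countF g
countF-cong {zero}  f≗g = refl
countF-cong {suc k} f≗g = cong₂ ℕ._+_ (cong (λ b → if b then 1 else 0) (f≗g zero)) (countF-cong (f≗g ∘ suc))

countF-split : ∀ a {b} (f : Fin (a ℕ.+ b) → Bool) →
               countF f ≡ countF (λ i → f (i ↑ˡ b)) ℕ.+ countF (λ i → f (a ↑ʳ i))
countF-split zero    f = refl
countF-split (suc a) f = trans (cong ((if f zero then 1 else 0) ℕ.+_) (countF-split a (f ∘ suc)))
                               (sym (ℕ.+-assoc (if f zero then 1 else 0) _ _))

countF-true : ∀ {k} (f : Fin k → Bool) → (∀ i → f i ≡ true) → countF f ≡ k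
countF-true {zero}  f f≡true = refl
countF-true {suc k} f f≡true rewrite f≡true zero = cong suc (countF-true (f ∘ suc) (f≡true ∘ suc))

countF-+-not : ∀ {k} (f : Fin k → Bool) → countF f ℕ.+ countF (not ∘ f) ≡ k
countF-+-not {zero}  f = refl
countF-+-not {suc k} f with f zero
... | true  = cong suc (countF-+-not (f ∘ suc))
... | false = trans (ℕ.+-suc _ _) (cong suc (countF-+-not (f ∘ suc)))

b2q-+≡1⇒≡not : ∀ {a b} → b2q a + b2q b ≡ 1ℚ → b ≡ not a
b2q-+≡1⇒≡not {true}  {false} _ = refl
b2q-+≡1⇒≡not {false} {true}  _ = refl
b2q-+≡1⇒≡not {true}  {true}  ()
b2q-+≡1⇒≡not {false} {false} ()

b2q-idem : ∀ b → b2q b * b2q b ≡ b2q b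
b2q-idem true  = refl
b2q-idem false = refl

‖toVect‖₀≡countF : ∀ {k} (f : Fin k → Bool) → ‖ toVect f ‖₀ ≡ countF f
‖toVect‖₀≡countF f = countF-cong (b2q≢0 ∘ f)
  where
  b2q≢0 : ∀ b → (if does (b2q b ℚ.≟ 0ℚ) then false else true) ≡ b
  b2q≢0 true  = refl
  b2q≢0 false = refl

‖toVect‖²≡countF : ∀ {k} (f : Fin k → Bool) → ‖ toVect f ‖² ≡ ℕtoℚ (countF f)
‖toVect‖²≡countF f = trans (sumF-cong (b2q-idem ∘ f)) (sumF-b2q f)

‖‖²-cong : ∀ {k} {v w : Vect k} → (∀ i → v i ≡ w i) → ‖ v ‖² ≡ ‖ w ‖²
‖‖²-cong v≗w = sumF-cong (λ i → cong₂ _*_ (v≗w i) (v≗w i))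

·-cong : ∀ {m k} (A : Mat m k) {v w : Vect k} → (∀ j → v j ≡ w j) → ∀ i → (A · v) i ≡ (A · w) i
·-cong A v≗w i = sumF-cong (λ j → cong (A i j *_) (v≗w j))

‖0‖² : ∀ {k} → ‖ (λ (_ : Fin k) → 0ℚ) ‖² ≡ 0ℚ
‖0‖² {k} = sumF-zero {k}

‖*‖² : ∀ {k} c (v : Vect k) → ‖ (λ i → c * v i) ‖² ≡ c * c * ‖ v ‖²
‖*‖² c v = trans (sumF-cong (λ i → solve 2 (λ c x → (c :* x) :* (c :* x) := c :* c :* (x :* x)) refl c (v i)))
                 (sumF-distribˡ-* (c * c) (λ i → v i * v i))
  where open +-*-Solver

vcat-↑ˡ : ∀ {a b k} (A : Mat a k) (B : Mat b k) i j → vcat A B (i ↑ˡ b) j ≡ A i j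
vcat-↑ˡ {a} {b} A B i j rewrite splitAt-↑ˡ a i b = refl

vcat-↑ʳ : ∀ {a b k} (A : Mat a k) (B : Mat b k) i j → vcat A B (a ↑ʳ i) j ≡ B i j
vcat-↑ʳ {a} {b} A B i j rewrite splitAt-↑ʳ a b i = refl

hcat-↑ˡ : ∀ {m a b} (A : Mat m a) (B : Mat m b) i j → hcat A B i (j ↑ˡ b) ≡ A i j
hcat-↑ˡ {a = a} {b} A B i j rewrite splitAt-↑ˡ a j b = refl

hcat-↑ʳ : ∀ {m a b} (A : Mat m a) (B : Mat m b) i j → hcat A B i (a ↑ʳ j) ≡ B i j
hcat-↑ʳ {a = a} {b} A B i j rewrite splitAt-↑ʳ a b j = refl

‖vcat·‖² : ∀ {a b k} (A : Mat a k) (B : Mat b k) v → ‖ vcat A B · v ‖² ≡ ‖ A · v ‖² + ‖ B · v ‖²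
‖vcat·‖² {a} A B v = trans (sumF-split a _) (cong₂ _+_ (‖‖²-cong top) (‖‖²-cong bottom))
  where
  top : ∀ i → (vcat A B · v) (i ↑ˡ _) ≡ (A · v) i
  top i = sumF-cong (λ j → cong (_* v j) (vcat-↑ˡ A B i j))
  bottom : ∀ i → (vcat A B · v) (a ↑ʳ i) ≡ (B · v) i
  bottom i = sumF-cong (λ j → cong (_* v j) (vcat-↑ʳ A B i j))

hcat-· : ∀ {m a b} (A : Mat m a) (B : Mat m b) v i →
         (hcat A B · v) i ≡ (A · (λ j → v (j ↑ˡ b))) i + (B · (λ j → v (a ↑ʳ j))) i
hcat-· {a = a} {b} A B v i = trans (sumF-split a _)
  (cong₂ _+_ (sumF-cong (λ j → cong (_* v (j ↑ˡ b)) (hcat-↑ˡ A B i j)))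
             (sumF-cong (λ j → cong (_* v (a ↑ʳ j)) (hcat-↑ʳ A B i j))))

blockRow : ∀ {m n} → Mat m n → Mat m n → Mat m n → Mat m (n ℕ.+ n ℕ.+ n)
blockRow {n = n} A B C = hcat {a = n ℕ.+ n} {b = n} (hcat {a = n} {b = n} A B) C

blockRow-· : ∀ {m n} (A B C : Mat m n) v i →
             (blockRow A B C · v) i ≡ (A · (v ∘ pos₁)) i + (B · (v ∘ pos₂)) i + (C · (v ∘ pos₃)) i
blockRow-· {n = n} A B C v i = trans (hcat-· (hcat A B) C v i) (cong (_+ _) (hcat-· A B _ i))

Id-· : ∀ {k} (v : Vect k) i → (Id · v) i ≡ v i
Id-· v i = sumF-δ i v

zeroM-· : ∀ {m k} (v : Vect k) (i : Fin m) → (zeroM · v) i ≡ 0ℚ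
zeroM-· {k = k} v i = trans (sumF-cong (*-zeroˡ ∘ v)) (sumF-zero {k})

scale-· : ∀ {m k} c (A : Mat m k) v i → (scale c A · v) i ≡ c * (A · v) i
scale-· {k = k} c A v i = trans (sumF-cong {k} (λ j → *-assoc c (A i j) (v j))) (sumF-distribˡ-* c (λ j → A i j * v j))

scale-Id-· : ∀ {k} c (v : Vect k) i → (scale c Id · v) i ≡ c * v i
scale-Id-· c v i = trans (scale-· c Id v i) (cong (c *_) (Id-· v i))

Pmat-·-1 : ∀ {k} (i : Fin k) → (Pmat · (λ _ → 1ℚ)) i ≡ 0ℚ
Pmat-·-1 {suc k} i = begin
  sumF {suc k} (λ j → (δ (toℕ i) (toℕ j) - c) * 1ℚ)
    ≡⟨ sumF-cong {suc k} (λ j → *-distribʳ-+ 1ℚ (δ (toℕ i) (toℕ j)) (- c)) ⟩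
  sumF {suc k} (λ j → δ (toℕ i) (toℕ j) * 1ℚ + - c * 1ℚ)
    ≡⟨ sumF-distrib-+ {suc k} (λ j → δ (toℕ i) (toℕ j) * 1ℚ) (λ _ → - c * 1ℚ) ⟩
  sumF {suc k} (λ j → δ (toℕ i) (toℕ j) * 1ℚ) + sumF {suc k} (λ _ → - c * 1ℚ)
    ≡⟨ cong₂ _+_ (Id-· (λ _ → 1ℚ) i) (sumF-const {suc k} (- c * 1ℚ)) ⟩
  1ℚ + ℕtoℚ (suc k) * (- c * 1ℚ)
    ≡⟨ solve 2 (λ N c → con 1ℚ :+ N :* (:- c :* con 1ℚ) := con 1ℚ :- N :* c) refl (ℕtoℚ (suc k)) c ⟩
  1ℚ - ℕtoℚ (suc k) * c
    ≡⟨ cong (λ x → 1ℚ - x) (ℕtoℚ-*-inverse k) ⟩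
  1ℚ - 1ℚ
    ≡⟨ +-inverseʳ 1ℚ ⟩
  0ℚ ∎
  where
  open ≡-Reasoning
  open +-*-Solver
  c = ℤ.+ 1 ℚ./ suc k

I′-·-1 : ∀ {m k} → m ℕ.≤ k → (c : Fin m) → (I′ {m} {k} · (λ _ → 1ℚ)) c ≡ 1ℚ
I′-·-1 {k = k} m≤k c = trans (sumF-cong {k} (λ j → cong (λ a → δ a (toℕ j) * 1ℚ) (sym (toℕ-inject≤ c m≤k))))
                             (Id-· (λ _ → 1ℚ) (inject≤ c m≤k))

∩-count : ∀ {k} (S : Subset k) (f : Fin k → Bool) →
          sumF (λ j → (if does (j ∈? S) then 1ℚ else 0ℚ) * b2q (f j)) ≡ ℕtoℚ ∣ S ∩ tabulate f ∣
∩-count []      f = refl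
∩-count (s ∷ S) f with s | f zero
... | true  | true  = trans (cong (1ℚ +_) (∩-count S (f ∘ suc))) (sym (ℕtoℚ-suc ∣ S ∩ tabulate (f ∘ suc) ∣))
... | true  | false = trans (+-identityˡ _) (∩-count S (f ∘ suc))
... | false | false = trans (+-identityˡ _) (∩-count S (f ∘ suc))
... | false | true  = trans (+-identityˡ _) (∩-count S (f ∘ suc))

Φmat-· : ∀ {n m} (φ : Instance n m) (f : Fin n → Bool) c →
         (Φmat φ · toVect f) c ≡ ℕtoℚ ∣ φ c ∩ tabulate f ∣
Φmat-· φ f c = ∩-count (φ c) f

module _ {n} (v : Vect (n ℕ.+ n ℕ.+ n)) where
  private
    b₁ b₂ b₃ : Vect n
    b₁ = v ∘ pos₁
    b₂ = v ∘ pos₂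
    b₃ = v ∘ pos₃

  blockRow-Id₁ : ∀ i → (blockRow Id zeroM zeroM · v) i ≡ b₁ i
  blockRow-Id₁ i = begin
    (blockRow Id zeroM zeroM · v) i                 ≡⟨ blockRow-· {n = n} Id zeroM zeroM v i ⟩
    (Id · b₁) i + (zeroM · b₂) i + (zeroM · b₃) i   ≡⟨ cong₂ _+_ (cong₂ _+_ (Id-· b₁ i) (zeroM-· b₂ i)) (zeroM-· b₃ i) ⟩
    b₁ i + 0ℚ + 0ℚ                                  ≡⟨ trans (+-identityʳ _) (+-identityʳ _) ⟩
    b₁ i                                            ∎
    where open ≡-Reasoning

  blockRow-Id₂ : ∀ i → (blockRow zeroM Id zeroM · v) i ≡ b₂ i
  blockRow-Id₂ i = begin
    (blockRow zeroM Id zeroM · v) i                 ≡⟨ blockRow-· {n = n} zeroM Id zeroM v i ⟩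
    (zeroM · b₁) i + (Id · b₂) i + (zeroM · b₃) i   ≡⟨ cong₂ _+_ (cong₂ _+_ (zeroM-· b₁ i) (Id-· b₂ i)) (zeroM-· b₃ i) ⟩
    0ℚ + b₂ i + 0ℚ                                  ≡⟨ trans (+-identityʳ _) (+-identityˡ _) ⟩
    b₂ i                                            ∎
    where open ≡-Reasoning

  module _ (b₃≡1 : ∀ j → b₃ j ≡ 1ℚ) where

    blockRow-P : ∀ c i → (blockRow zeroM zeroM (scale c Pmat) · v) i ≡ 0ℚ
    blockRow-P c i = begin
      (blockRow zeroM zeroM (scale c Pmat) · v) i               ≡⟨ blockRow-· {n = n} zeroM zeroM (scale c Pmat) v i ⟩
      (zeroM · b₁) i + (zeroM · b₂) i + (scale c Pmat · b₃) i   ≡⟨ cong₂ _+_ (cong₂ _+_ (zeroM-· b₁ i) (zeroM-· b₂ i))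
                                                                             (scale-· c Pmat b₃ i) ⟩
      0ℚ + 0ℚ + c * (Pmat · b₃) i                               ≡⟨ +-identityˡ _ ⟩
      c * (Pmat · b₃) i                                         ≡⟨ cong (c *_) (trans (·-cong Pmat b₃≡1 i) (Pmat-·-1 i)) ⟩
      c * 0ℚ                                                    ≡⟨ *-zeroʳ c ⟩
      0ℚ                                                        ∎
      where open ≡-Reasoning

    blockRow-balance : (∀ i → b₁ i + b₂ i ≡ 1ℚ) →
                       ∀ c i → (blockRow (scale c Id) (scale c Id) (scale (- c) Id) · v) i ≡ 0ℚ
    blockRow-balance b₁+b₂≡1 c i = begin
      (blockRow (scale c Id) (scale c Id) (scale (- c) Id) · v) i
        ≡⟨ blockRow-· {n = n} (scale c Id) (scale c Id) (scale (- c) Id) v i ⟩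
      (scale c Id · b₁) i + (scale c Id · b₂) i + (scale (- c) Id · b₃) i
        ≡⟨ cong₂ _+_ (cong₂ _+_ (scale-Id-· c b₁ i) (scale-Id-· c b₂ i)) (scale-Id-· (- c) b₃ i) ⟩
      c * b₁ i + c * b₂ i + - c * b₃ i
        ≡⟨ cong (λ x → c * b₁ i + c * b₂ i + - c * x) (b₃≡1 i) ⟩
      c * b₁ i + c * b₂ i + - c * 1ℚ
        ≡⟨ solve 3 (λ c x y → c :* x :+ c :* y :+ (:- c) :* con 1ℚ := c :* (x :+ y) :- c :* con 1ℚ) refl c (b₁ i) (b₂ i) ⟩
      c * (b₁ i + b₂ i) - c * 1ℚ
        ≡⟨ cong (λ x → c * x - c * 1ℚ) (b₁+b₂≡1 i) ⟩
      c * 1ℚ - c * 1ℚ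
        ≡⟨ +-inverseʳ (c * 1ℚ) ⟩
      0ℚ ∎
      where
      open ≡-Reasoning
      open +-*-Solver

blockRow-clause : ∀ {n m} (φ : Instance n m) → m ℕ.≤ n → (u : Fin (n ℕ.+ n ℕ.+ n) → Bool) →
                  (∀ j → toVect u (pos₃ {n} j) ≡ 1ℚ) →
                  ∀ ε c → (blockRow (scale ε (Φmat φ)) zeroM (scale (- ε) I′) · toVect u) c
                          ≡ ε * (ℕtoℚ (trueCount φ u c) - 1ℚ)
blockRow-clause {n} φ m≤n u b₃≡1 ε c = begin
  (blockRow (scale ε (Φmat φ)) zeroM (scale (- ε) I′) · toVect u) c
    ≡⟨ blockRow-· {n = n} (scale ε (Φmat φ)) zeroM (scale (- ε) I′) (toVect u) c ⟩
  (scale ε (Φmat φ) · b₁) c + (zeroM · b₂) c + (scale (- ε) I′ · b₃) c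
    ≡⟨ cong₂ _+_ (cong₂ _+_ (trans (scale-· ε (Φmat φ) b₁ c) (cong (ε *_) (Φmat-· φ (u ∘ pos₁) c)))
                            (zeroM-· b₂ c))
                 (trans (scale-· (- ε) I′ b₃ c) (cong (- ε *_) (trans (·-cong I′ b₃≡1 c) (I′-·-1 m≤n c)))) ⟩
  ε * t + 0ℚ + - ε * 1ℚ
    ≡⟨ solve 2 (λ ε t → ε :* t :+ con 0ℚ :+ (:- ε) :* con 1ℚ := ε :* (t :- con 1ℚ)) refl ε t ⟩
  ε * (t - 1ℚ) ∎
  where
  open ≡-Reasoning
  open +-*-Solver
  t = ℕtoℚ (trueCount φ u c)
  b₁ b₂ b₃ : Vect n
  b₁ = toVect u ∘ pos₁
  b₂ = toVect u ∘ pos₂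
  b₃ = toVect u ∘ pos₃

module _ {n} {u : Fin (n ℕ.+ n ℕ.+ n) → Bool} (asg : IsAssignment {n} u) where
  private
    x₁ x₂ x₃ : Fin n → Bool
    x₁ = u ∘ pos₁
    x₂ = u ∘ pos₂
    x₃ = u ∘ pos₃

  countF-pos₁+pos₂ : countF x₁ ℕ.+ countF x₂ ≡ n
  countF-pos₁+pos₂ = trans (cong (countF x₁ ℕ.+_) (countF-cong (b2q-+≡1⇒≡not ∘ proj₁ asg))) (countF-+-not x₁)

  ‖pos₁‖²+‖pos₂‖² : ‖ toVect x₁ ‖² + ‖ toVect x₂ ‖² ≡ ℕtoℚ n
  ‖pos₁‖²+‖pos₂‖² = begin
    ‖ toVect x₁ ‖² + ‖ toVect x₂ ‖²        ≡⟨ cong₂ _+_ (‖toVect‖²≡countF x₁) (‖toVect‖²≡countF x₂) ⟩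
    ℕtoℚ (countF x₁) + ℕtoℚ (countF x₂)    ≡⟨ ℕtoℚ-+ (countF x₁) (countF x₂) ⟨
    ℕtoℚ (countF x₁ ℕ.+ countF x₂)         ≡⟨ cong ℕtoℚ countF-pos₁+pos₂ ⟩
    ℕtoℚ n                                 ∎
    where open ≡-Reasoning

  countF-assignment : countF u ≡ 2 ℕ.* n
  countF-assignment = begin
    countF u                                        ≡⟨ countF-split (n ℕ.+ n) u ⟩
    countF (λ i → u (i ↑ˡ n)) ℕ.+ countF x₃         ≡⟨ cong (ℕ._+ countF x₃) (countF-split n _) ⟩
    countF x₁ ℕ.+ countF x₂ ℕ.+ countF x₃           ≡⟨ cong₂ ℕ._+_ countF-pos₁+pos₂ (countF-true x₃ (proj₂ asg)) ⟩
    n ℕ.+ n                                         ≡⟨ cong (n ℕ.+_) (ℕ.+-identityʳ n) ⟨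
    2 ℕ.* n                                         ∎
    where open ≡-Reasoning

square-nonNeg : ∀ p → NonNegative (p * p)
square-nonNeg p with ≤-total 0ℚ p
... | inj₁ 0≤p = nonNeg*nonNeg⇒nonNeg p {{nonNegative 0≤p}} p {{nonNegative 0≤p}}
... | inj₂ p≤0 = nonPos*nonPos⇒nonPos p {{nonPositive p≤0}} p {{nonPositive p≤0}}

defect : ℕ → ℚ
defect t = (ℕtoℚ t - 1ℚ) * (ℕtoℚ t - 1ℚ)

unsatisfied? : ℕ → Bool
unsatisfied? t = if does (t ℕ.≟ 1) then false else true

unsatisfied≤defect : ∀ {t} → t ℕ.≤ 3 → b2q (unsatisfied? t) ≤ defect t
unsatisfied≤defect {0} _ = ≤-refl
unsatisfied≤defect {1} _ = ≤-refl
unsatisfied≤defect {2} _ = ≤-refl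
unsatisfied≤defect {3} _ = toWitness {a? = 1ℚ ≤? ℕtoℚ 4} _
unsatisfied≤defect {suc (suc (suc (suc _)))} (s≤s (s≤s (s≤s ())))

defect≤4*unsatisfied : ∀ {t} → t ℕ.≤ 3 → defect t ≤ ℕtoℚ 4 * b2q (unsatisfied? t)
defect≤4*unsatisfied {0} _ = toWitness {a? = 1ℚ ≤? ℕtoℚ 4} _
defect≤4*unsatisfied {1} _ = ≤-refl
defect≤4*unsatisfied {2} _ = toWitness {a? = 1ℚ ≤? ℕtoℚ 4} _
defect≤4*unsatisfied {3} _ = ≤-refl
defect≤4*unsatisfied {suc (suc (suc (suc _)))} (s≤s (s≤s (s≤s ())))

defect≡unsatisfied : ∀ {t} → t ℕ.≤ 3 → t ≢ 3 → defect t ≡ b2q (unsatisfied? t)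
defect≡unsatisfied {0} _ _ = refl
defect≡unsatisfied {1} _ _ = refl
defect≡unsatisfied {2} _ _ = refl
defect≡unsatisfied {3} _ t≢3 = ⊥-elim (t≢3 refl)
defect≡unsatisfied {suc (suc (suc (suc _)))} (s≤s (s≤s (s≤s ())))

module _ {m} (t : Fin m → ℕ) (t≤3 : ∀ c → t c ℕ.≤ 3) where

  unsatisfied≤sumF-defect : ℕtoℚ (countF (unsatisfied? ∘ t)) ≤ sumF (defect ∘ t)
  unsatisfied≤sumF-defect = subst (_≤ sumF (defect ∘ t)) (sumF-b2q (unsatisfied? ∘ t))
                                  (sumF-mono-≤ (unsatisfied≤defect ∘ t≤3))

  sumF-defect≤4*unsatisfied : sumF (defect ∘ t) ≤ ℕtoℚ 4 * ℕtoℚ (countF (unsatisfied? ∘ t))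
  sumF-defect≤4*unsatisfied =
    subst (sumF (defect ∘ t) ≤_)
          (trans (sumF-distribˡ-* (ℕtoℚ 4) (b2q ∘ unsatisfied? ∘ t)) (cong (ℕtoℚ 4 *_) (sumF-b2q (unsatisfied? ∘ t))))
          (sumF-mono-≤ (defect≤4*unsatisfied ∘ t≤3))

  sumF-defect≡unsatisfied : (∀ c → t c ≢ 3) → sumF (defect ∘ t) ≡ ℕtoℚ (countF (unsatisfied? ∘ t))
  sumF-defect≡unsatisfied t≢3 = trans (sumF-cong (λ c → defect≡unsatisfied (t≤3 c) (t≢3 c))) (sumF-b2q (unsatisfied? ∘ t))

‖Xtilde·assignment‖² : ∀ {n m} (φ : Instance n m) → m ℕ.≤ n → (ξ ε : ℚ) (ξpos : 0ℚ < ξ) →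
                       (u : Fin (n ℕ.+ n ℕ.+ n) → Bool) → IsAssignment {n} u →
                       ‖ Xtilde φ ξ ε ξpos · toVect u ‖² ≡ ℕtoℚ n + ε * ε * sumF (defect ∘ trueCount φ u)
‖Xtilde·assignment‖² {n} {m} φ m≤n ξ ε ξpos u asg@(exactlyOne , lastTrue) = begin
  ‖ Xtilde φ ξ ε ξpos · v ‖²
    ≡⟨ ‖vcat·‖² V₄ R₅ v ⟩
  ‖ V₄ · v ‖² + ‖ R₅ · v ‖²
    ≡⟨ cong (_+ ‖ R₅ · v ‖²) (‖vcat·‖² V₃ R₄ v) ⟩
  ‖ V₃ · v ‖² + ‖ R₄ · v ‖² + ‖ R₅ · v ‖²
    ≡⟨ cong (λ x → x + ‖ R₄ · v ‖² + ‖ R₅ · v ‖²) (‖vcat·‖² V₂ R₃ v) ⟩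
  ‖ V₂ · v ‖² + ‖ R₃ · v ‖² + ‖ R₄ · v ‖² + ‖ R₅ · v ‖²
    ≡⟨ cong (λ x → x + ‖ R₃ · v ‖² + ‖ R₄ · v ‖² + ‖ R₅ · v ‖²) (‖vcat·‖² R₁ R₂ v) ⟩
  ‖ R₁ · v ‖² + ‖ R₂ · v ‖² + ‖ R₃ · v ‖² + ‖ R₄ · v ‖² + ‖ R₅ · v ‖²
    ≡⟨ cong₂ _+_ (cong₂ _+_ (cong₂ _+_ (cong₂ _+_ (‖‖²-cong (blockRow-Id₁ {n} v)) (‖‖²-cong (blockRow-Id₂ {n} v)))
                                       (‖‖²-cong {n} (blockRow-P {n} v b₃≡1 ξ⁻¹)))
                            (‖‖²-cong {n} (blockRow-balance {n} v b₃≡1 exactlyOne ξ⁻¹)))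
                 (‖‖²-cong (blockRow-clause φ m≤n u b₃≡1 ε)) ⟩
  ‖ b₁ ‖² + ‖ b₂ ‖² + ‖ 0ᵥ ‖² + ‖ 0ᵥ ‖² + ‖ (λ c → ε * (ℕtoℚ (trueCount φ u c) - 1ℚ)) ‖²
    ≡⟨ cong₂ _+_ (cong₂ _+_ (cong₂ _+_ (‖pos₁‖²+‖pos₂‖² {n} {u} asg) (‖0‖² {n})) (‖0‖² {n})) (‖*‖² ε (λ c → ℕtoℚ (trueCount φ u c) - 1ℚ)) ⟩
  ℕtoℚ n + 0ℚ + 0ℚ + ε * ε * sumF (defect ∘ trueCount φ u)
    ≡⟨ cong (_+ ε * ε * sumF (defect ∘ trueCount φ u)) (trans (+-identityʳ (ℕtoℚ n + 0ℚ)) (+-identityʳ (ℕtoℚ n))) ⟩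
  ℕtoℚ n + ε * ε * sumF (defect ∘ trueCount φ u) ∎
  where
  open ≡-Reasoning
  v : Vect (n ℕ.+ n ℕ.+ n)
  v = toVect u
  b₁ b₂ : Vect n
  b₁ = v ∘ pos₁
  b₂ = v ∘ pos₂
  ξ⁻¹ = inv ξ ξpos
  0ᵥ : Vect n
  0ᵥ _ = 0ℚ
  b₃≡1 : ∀ j → v (pos₃ {n} j) ≡ 1ℚ
  b₃≡1 j = cong b2q (lastTrue j)
  R₁ R₂ R₃ R₄ : Mat n (n ℕ.+ n ℕ.+ n)
  R₁ = blockRow Id zeroM zeroM
  R₂ = blockRow zeroM Id zeroM
  R₃ = blockRow zeroM zeroM (scale ξ⁻¹ Pmat)
  R₄ = blockRow (scale ξ⁻¹ Id) (scale ξ⁻¹ Id) (scale (- ξ⁻¹) Id)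
  R₅ : Mat m (n ℕ.+ n ℕ.+ n)
  R₅ = blockRow (scale ε (Φmat φ)) zeroM (scale (- ε) I′)
  V₂ = vcat {n} {n} R₁ R₂
  V₃ = vcat {n ℕ.+ n} {n} V₂ R₃
  V₄ = vcat {n ℕ.+ n ℕ.+ n} {n} V₃ R₄

proposition2 : ∀ {n m} (φ : Instance n m) → WellFormed φ → m ℕ.≤ n →
    (ξ ε : ℚ) (ξpos : 0ℚ < ξ) → ξ < ε → ε < 1ℚ →
    (u : Fin (n ℕ.+ n ℕ.+ n) → Bool) → IsAssignment {n} u →
    (‖ toVect u ‖² ≡ ℕtoℚ (2 ℕ.* n)) × (‖ toVect u ‖₀ ≡ 2 ℕ.* n) ×
    (ℕtoℚ n + ε * ε * ℕtoℚ (unsatCount φ u) ≤ ‖ Xtilde φ ξ ε ξpos · toVect u ‖²) ×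
    (‖ Xtilde φ ξ ε ξpos · toVect u ‖² ≤ ℕtoℚ n + ℕtoℚ 4 * (ε * ε) * ℕtoℚ (unsatCount φ u)) ×
    ((∀ c → trueCount φ u c ≢ 3) →
      ‖ Xtilde φ ξ ε ξpos · toVect u ‖² ≡ ℕtoℚ n + ε * ε * ℕtoℚ (unsatCount φ u))
proposition2 {n} φ wf m≤n ξ ε ξpos _ _ u asg =
  trans (‖toVect‖²≡countF u) (cong ℕtoℚ (countF-assignment {n} {u} asg)) ,
  trans (‖toVect‖₀≡countF u) (countF-assignment {n} {u} asg) ,
  lower , upper , tight
  where
  open ≤-Reasoning
  t = trueCount φ u
  t≤3 : ∀ c → t c ℕ.≤ 3
  t≤3 c = ℕ.≤-trans (∣p∩q∣≤∣p∣ (φ c) (trueSet u)) (wf c)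
  e = ε * ε
  D = sumF (defect ∘ t)
  U = ℕtoℚ (unsatCount φ u)
  ‖Xu‖² : ‖ Xtilde φ ξ ε ξpos · toVect u ‖² ≡ ℕtoℚ n + e * D
  ‖Xu‖² = ‖Xtilde·assignment‖² φ m≤n ξ ε ξpos u asg
  n+e*-mono : ∀ {x y} → x ≤ y → ℕtoℚ n + e * x ≤ ℕtoℚ n + e * y
  n+e*-mono x≤y = +-monoʳ-≤ (ℕtoℚ n) (*-monoˡ-≤-nonNeg e {{square-nonNeg ε}} x≤y)

  lower : ℕtoℚ n + e * U ≤ ‖ Xtilde φ ξ ε ξpos · toVect u ‖²
  lower = begin
    ℕtoℚ n + e * U                     ≤⟨ n+e*-mono (unsatisfied≤sumF-defect t t≤3) ⟩
    ℕtoℚ n + e * D                     ≡⟨ ‖Xu‖² ⟨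
    ‖ Xtilde φ ξ ε ξpos · toVect u ‖²  ∎

  upper : ‖ Xtilde φ ξ ε ξpos · toVect u ‖² ≤ ℕtoℚ n + ℕtoℚ 4 * e * U
  upper = begin
    ‖ Xtilde φ ξ ε ξpos · toVect u ‖²  ≡⟨ ‖Xu‖² ⟩
    ℕtoℚ n + e * D                     ≤⟨ n+e*-mono (sumF-defect≤4*unsatisfied t t≤3) ⟩
    ℕtoℚ n + e * (ℕtoℚ 4 * U)          ≡⟨ cong (ℕtoℚ n +_) (trans (sym (*-assoc e (ℕtoℚ 4) U)) (cong (_* U) (*-comm e (ℕtoℚ 4)))) ⟩
    ℕtoℚ n + ℕtoℚ 4 * e * U            ∎

  tight : (∀ c → t c ≢ 3) → ‖ Xtilde φ ξ ε ξpos · toVect u ‖² ≡ ℕtoℚ n + e * U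
  tight t≢3 = trans ‖Xu‖² (cong (λ d → ℕtoℚ n + e * d) (sumF-defect≡unsatisfied t t≤3 t≢3))
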